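{- Let $C$ be a finite set of clients, $F$ a finite set of facilities, $d$ a metric on $C\cup F$, $F_1,F_2\subseteq F$, and $\sigma_1:C\to F_1$, $\sigma_2:C\to F_2$ assignments. For $i\in F_2$ let $\eta(i)$ be the facility of $F_1$ nearest to $i$ (distances assumed distinct). Let $\hat{\sigma}_1:C\to F_1$ be the assignment produced from $\sigma_1$ by the cycle-breaking procedure described below. Then for every client $j\in C$, $$d(j,\hat{\sigma}_1(j))\le d(j,\sigma_1(j))+2\,d(j,\sigma_2(j)).$$
   Context: For $i\in F_1$ with $\eta^{ -1}(i)\neq\emptyset$, the star $S_i$ is $\{i\}\cup\eta^{ -1}(i)$. The weighted directed graph $G_2$ has the stars as vertices and an edge $(S_{i_1},S_{i_2})$ of weight $w(S_{i_1},S_{i_2})=\bigl|\sigma_1^{ -1}(i_1)\cap\bigcup_{i'\in\eta^{ -1}(i_2)}\sigma_2^{ -1}(i')\bigr|$ whenever this weight is positive. Cycle-breaking procedure: start with $\hat{\sigma}_1=\sigma_1$. For each directed cycle $\langle S_{i_1},\dots,S_{i_l}\rangle$ (of length at least 2) in $G_2$, with, say, $(S_{i_1},S_{i_2})$ an edge of minimum weight $\kappa$ on it, for each $r=1,\dots,l$ (indices mod $l$, so $i_{l+1}=i_1$) choose arbitrarily $\kappa$ clients $j$ in $\sigma_1^{ -1}(i_r)\cap\bigcup_{i'\in\eta^{ -1}(i_{r+1})}\sigma_2^{ -1}(i')$, set $\hat{\sigma}_1(j)=i_{r+1}$ for these clients, and decrease $w(S_{i_r},S_{i_{r+1}})$ by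 $\kappa$ (removing edges of weight zero). Repeat until the only directed cycles remaining are self-loops.
   Formalization: The metric d on C ∪ F takes rational values. -}

module Defs where

open import Data.Nat as ℕ using (ℕ; zero; suc; _∸_)
open import Data.Fin using (Fin; zero; suc)
open import Data.Fin.Properties using (_≟_)
open import Data.Fin.Subset using (Subset; _∈_)
open import Data.Sum using (_⊎_; inj₁; inj₂)
open import Data.Product using (Σ; ∃; _×_; _,_)
open import Data.List using (List; length; filter; allFin)
open import Data.List.Membership.Propositional as LM using ()
open import Data.List.Relation.Unary.Unique.Propositional using (Unique)
open import Data.Rational as ℚ using (ℚ; 0ℚ)
open import Function.Definitions using (Injective)
open import Relation.Binary.PropositionalEquality using (_≡_; _≢_)
open import Relation.Binary.Construct.Closure.ReflexiveTransitive using (Star)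
open import Relation.Nullary using (¬_)
open import Relation.Nullary.Decidable using (_×-dec_)

Point : ℕ → ℕ → Set
Point nC nF = Fin nC ⊎ Fin nF

record IsMetric {X : Set} (d : X → X → ℚ) : Set where
  field
    nonneg   : ∀ x y → 0ℚ ℚ.≤ d x y
    zero-iff : ∀ x y → d x y ≡ 0ℚ → x ≡ y
    refl0    : ∀ x → d x x ≡ 0ℚ
    symm     : ∀ x y → d x y ≡ d y x
    triangle : ∀ x y z → d x z ℚ.≤ d x y ℚ.+ d y z

-- Cyclic successor on Fin (suc n): r ↦ r+1 mod (suc n).
rot : ∀ {n} → Fin (suc n) → Fin (suc n)
rot {zero}  zero    = zero
rot {suc n} zero    = suc zero
rot {suc n} (suc i) with rot {n} i
... | zero  = zero
... | suc k = suc (suc k)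

-- Weighted digraph on facilities (stars S_i are identified with their centre i);
-- an edge (a,b) is present iff its weight is positive.
Weights : ℕ → Set
Weights nF = Fin nF → Fin nF → ℕ

-- Initial weight w(S_a, S_b) = |σ₁⁻¹(a) ∩ ⋃_{i' ∈ η⁻¹(b)} σ₂⁻¹(i')|,
-- i.e. the number of clients j with σ₁ j = a and η (σ₂ j) = b.
initWeight : ∀ {nC nF} → (Fin nC → Fin nF) → (Fin nC → Fin nF) → (Fin nF → Fin nF) → Weights nF
initWeight {nC} σ₁ σ₂ η a b =
  length (filter (λ j → (σ₁ j ≟ a) ×-dec (η (σ₂ j) ≟ b)) (allFin nC))

record Cycle {nF : ℕ} (w : Weights nF) : Set where
  field
    m     : ℕ
    v     : Fin (suc (suc m)) → Fin nF
    v-inj : Injective _≡_ _≡_ v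
    edges : ∀ r → 0 ℕ.< w (v r) (v (rot r))

HasCycle : ∀ {nF} → Weights nF → Set
HasCycle w = Cycle w

State : ℕ → ℕ → Set
State nC nF = (Fin nC → Fin nF) × Weights nF

record Step {nC nF : ℕ} (σ₁ σ₂ : Fin nC → Fin nF) (η : Fin nF → Fin nF)
            (s s' : State nC nF) : Set where
  field
    cyc    : Cycle (Data.Product.proj₂ s)
  open Cycle cyc
  w  = Data.Product.proj₂ s
  w' = Data.Product.proj₂ s'
  σ̂  = Data.Product.proj₁ s
  σ̂' = Data.Product.proj₁ s'
  field
    κ       : ℕ
    κ-lower : ∀ r → κ ℕ.≤ w (v r) (v (rot r))
    κ-attn  : ∃ λ r → w (v r) (v (rot r)) ≡ κ
    chosen      : Fin (suc (suc m)) → List (Fin nC)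
    chosen-uniq : ∀ r → Unique (chosen r)
    chosen-len  : ∀ r → length (chosen r) ≡ κ
    chosen-src  : ∀ r j → j LM.∈ chosen r → σ₁ j ≡ v r
    chosen-dst  : ∀ r j → j LM.∈ chosen r → η (σ₂ j) ≡ v (rot r)
    moved   : ∀ r j → j LM.∈ chosen r → σ̂' j ≡ v (rot r)
    unmoved : ∀ j → (∀ r → ¬ (j LM.∈ chosen r)) → σ̂' j ≡ σ̂ j
    w-cyc   : ∀ r → w' (v r) (v (rot r)) ≡ w (v r) (v (rot r)) ∸ κ
    w-other : ∀ a b → (∀ r → ¬ (a ≡ v r × b ≡ v (rot r))) → w' a b ≡ w a b

IsCycleBreakingOutput : ∀ {nC nF} (σ₁ σ₂ : Fin nC → Fin nF) (η : Fin nF → Fin nF)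
                        (σ̂₁ : Fin nC → Fin nF) → Set
IsCycleBreakingOutput σ₁ σ₂ η σ̂₁ =
  Σ (Weights _) λ wf →
    Star (Step σ₁ σ₂ η) (σ₁ , initWeight σ₁ σ₂ η) (σ̂₁ , wf) × ¬ HasCycle wf

{-# OPTIONS --safe #-}
-- A cycle-breaking step only moves a client j along an edge from the star of σ₁ j to the star
-- S_{η (σ₂ j)} that contains σ₂ j, so throughout the procedure each client is assigned either
-- σ₁ j or η (σ₂ j). In the second case, since η (σ₂ j) is the F₁-facility nearest to σ₂ j,
--   d(j, η (σ₂ j)) ≤ d(j, σ₂ j) + d(σ₂ j, σ₁ j) ≤ d(j, σ₁ j) + 2 d(j, σ₂ j).
module Submission where

open import Defs
open import Data.Nat using (ℕ)
open import Data.Fin using (Fin)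
open import Data.Fin.Properties using (_≟_; any?)
open import Data.Fin.Subset using (Subset; _∈_)
open import Data.Sum as Sum using (inj₁; inj₂; _⊎_)
open import Data.Product using (_,_; proj₁)
open import Data.Rational using (ℚ; _≤_; _+_; 0ℚ)
open import Data.Rational.Properties using (+-assoc; +-comm; +-identityʳ; +-mono-≤; +-monoʳ-≤; module ≤-Reasoning)
import Data.List.Membership.DecPropositional as DecMembership
open import Relation.Binary.PropositionalEquality using (_≡_; refl; sym; trans; cong)
open import Relation.Binary.Construct.Closure.ReflexiveTransitive using (Star; ε; _◅_)
open import Relation.Nullary using (yes; no)

module _ {X : Set} {d : X → X → ℚ} (metric : IsMetric d) where
  open IsMetric metric
  open ≤-Reasoning

  ≤-+-double : ∀ x y z → d x y ≤ d x y + (d x z + d x z)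
  ≤-+-double x y z = begin
    d x y                   ≡⟨ sym (+-identityʳ (d x y)) ⟩
    d x y + 0ℚ              ≤⟨ +-monoʳ-≤ (d x y) (+-mono-≤ (nonneg x z) (nonneg x z)) ⟩
    d x y + (d x z + d x z) ∎

  via-nearer-≤ : ∀ j a i b → d i b ≤ d i a → d j b ≤ d j a + (d j i + d j i)
  via-nearer-≤ j a i b nearer = begin
    d j b                   ≤⟨ triangle j i b ⟩
    d j i + d i b           ≤⟨ +-monoʳ-≤ (d j i) nearer ⟩
    d j i + d i a           ≤⟨ +-monoʳ-≤ (d j i) (triangle i j a) ⟩
    d j i + (d i j + d j a) ≡⟨ cong (λ t → d j i + (t + d j a)) (symm i j) ⟩
    d j i + (d j i + d j a) ≡⟨ sym (+-assoc (d j i) (d j i) (d j a)) ⟩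
    (d j i + d j i) + d j a ≡⟨ +-comm (d j i + d j i) (d j a) ⟩
    d j a + (d j i + d j i) ∎

module _ {nC nF : ℕ} (σ₁ σ₂ : Fin nC → Fin nF) (η : Fin nF → Fin nF) where
  open DecMembership (_≟_ {nC}) using (_∈?_)

  InitialOrNearest : (Fin nC → Fin nF) → Set
  InitialOrNearest σ̂ = ∀ j → σ̂ j ≡ σ₁ j ⊎ σ̂ j ≡ η (σ₂ j)

  Step-preserves-InitialOrNearest : ∀ {s s'} → Step σ₁ σ₂ η s s' →
                                    InitialOrNearest (proj₁ s) → InitialOrNearest (proj₁ s')
  Step-preserves-InitialOrNearest st inv j with any? (λ r → j ∈? Step.chosen st r)
  ... | yes (r , j∈) = inj₂ (trans (Step.moved st r j j∈) (sym (Step.chosen-dst st r j j∈)))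
  ... | no j∉ = Sum.map (trans unmoved) (trans unmoved) (inv j)
    where unmoved = Step.unmoved st j (λ r j∈ → j∉ (r , j∈))

  Star-preserves-InitialOrNearest : ∀ {s s'} → Star (Step σ₁ σ₂ η) s s' →
                                    InitialOrNearest (proj₁ s) → InitialOrNearest (proj₁ s')
  Star-preserves-InitialOrNearest ε          inv = inv
  Star-preserves-InitialOrNearest (st ◅ sts) inv =
    Star-preserves-InitialOrNearest sts (Step-preserves-InitialOrNearest st inv)

  output-InitialOrNearest : ∀ {σ̂₁} → IsCycleBreakingOutput σ₁ σ₂ η σ̂₁ → InitialOrNearest σ̂₁
  output-InitialOrNearest (_ , run , _) = Star-preserves-InitialOrNearest run (λ _ → inj₁ refl)

lemma1 : (nC nF : ℕ) (d : Point nC nF → Point nC nF → ℚ) → IsMetric d →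
    (F₁ F₂ : Subset nF) (σ₁ σ₂ : Fin nC → Fin nF) →
    (∀ j → σ₁ j ∈ F₁) → (∀ j → σ₂ j ∈ F₂) →
    (η : Fin nF → Fin nF) →
    (∀ i → i ∈ F₂ → η i ∈ F₁) →
    (∀ i i' → i ∈ F₂ → i' ∈ F₁ → d (inj₂ i) (inj₂ (η i)) ≤ d (inj₂ i) (inj₂ i')) →
    (∀ i a b → i ∈ F₂ → a ∈ F₁ → b ∈ F₁ → d (inj₂ i) (inj₂ a) ≡ d (inj₂ i) (inj₂ b) → a ≡ b) →
    (σ̂₁ : Fin nC → Fin nF) → IsCycleBreakingOutput σ₁ σ₂ η σ̂₁ →
    ∀ j → d (inj₁ j) (inj₂ (σ̂₁ j)) ≤ d (inj₁ j) (inj₂ (σ₁ j)) + (d (inj₁ j) (inj₂ (σ₂ j)) + d (inj₁ j) (inj₂ (σ₂ j)))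
lemma1 nC nF d metric F₁ F₂ σ₁ σ₂ σ₁∈F₁ σ₂∈F₂ η _ η-nearest _ σ̂₁ output j
  with output-InitialOrNearest σ₁ σ₂ η output j
... | inj₁ initial rewrite initial =
  ≤-+-double metric (inj₁ j) (inj₂ (σ₁ j)) (inj₂ (σ₂ j))
... | inj₂ nearest rewrite nearest =
  via-nearer-≤ metric (inj₁ j) (inj₂ (σ₁ j)) (inj₂ (σ₂ j)) (inj₂ (η (σ₂ j)))
    (η-nearest (σ₂ j) (σ₁ j) (σ₂∈F₂ j) (σ₁∈F₁ j))
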